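{- Let $G=(V,E,\beta)$ be a temporal graph, $s,t\in V$ with $s\neq t$, and $e\in E$ a temporal edge. Then $\sigma^*_{s,e,t}=\sigma_{s,e}\cdot\theta_{s,e,t}$.
   Context: A temporal graph is $G=(V,E,\beta)$ with $\beta\in\mathbb{N}\cup\{+\infty\}$. A temporal edge $e=(u,v,\tau,\lambda)$ has tail $u$, head $v$, departure time $\tau\in\mathbb{N}$, travel time $\lambda\in\mathbb{N}^+$, arrival time $\mathrm{arr}(e)=\tau+\lambda$. An $st$-walk is a sequence $e_1,\dots,e_k$ of temporal edges $e_i=(u_i,v_i,\tau_i,\lambda_i)$ with $u_1=s$, $v_k=t$, and $u_{i+1}=v_i$, $\mathrm{arr}(e_i)\le\tau_{i+1}\le\mathrm{arr}(e_i)+\beta$ for $i<k$; it is also called an $se_k$-walk. Its length is $|W|=k$ and $\mathrm{arr}(W)=\mathrm{arr}(e_k)$. An $st$-walk $W$ is shortest foremost (SFo) if no $st$-walk $X$ has $\mathrm{arr}(X)<\mathrm{arr}(W)$, or $\mathrm{arr}(X)=\mathrm{arr}(W)$ and $|X|<|W|$. $\sigma_{s,e}$ is the number of $se$-walks of minimum length. $\mathcal{W}_{s,e,t}$ is the set of SFo $st$-walks containing $e$ and $\sigma^*_{s,e,t}=|\mathcal{W}_{s,e,t}|$. Each $W\in\mathcal{W}_{s,e,t}$ decomposes into a prefix ending with $e$ and a suffix (the part after $e$, possibly empty); $\theta_{s,e,t}$ is the number of distinct suffixes of walks in $\mathcal{W}_{s,e,t}$ (including possibly the empty suffix). -}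

module Defs where

open import Data.Nat using (ℕ; _+_; _≤_; _<_)
open import Data.Fin using (Fin)
open import Data.List using (List; []; _∷_; length; _++_)
open import Data.List.Membership.Propositional using (_∈_)
open import Data.List.Relation.Unary.All using (All)
open import Data.List.Relation.Unary.Unique.Propositional using (Unique)
open import Data.Product using (Σ; ∃; _×_; _,_)
open import Data.Unit using (⊤)
open import Data.Empty using (⊥)
open import Relation.Nullary using (¬_)
open import Relation.Binary.PropositionalEquality using (_≡_)
open import Function.Bundles using (_⇔_)

data ℕ∞ : Set where
  fin : ℕ → ℕ∞
  ∞   : ℕ∞

record TEdge (n : ℕ) : Set where
  constructor tedge
  field
    src  : Fin n
    dst  : Fin n
    dep  : ℕ
    trav : ℕ       -- travel time λ (positive, enforced in TemporalGraph)
open TEdge public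

arr : ∀ {n} → TEdge n → ℕ
arr e = dep e + trav e

record TemporalGraph : Set where
  field
    n        : ℕ
    E        : List (TEdge n)
    E-unique : Unique E
    E-pos    : All (λ e → 1 ≤ trav e) E
    β        : ℕ∞
open TemporalGraph public

WithinWait : ℕ∞ → ℕ → ℕ → Set
WithinWait (fin b) a τ' = τ' ≤ a + b
WithinWait ∞       a τ' = ⊤

-- Cont G e rest : e followed by rest is a valid sequence of consecutive temporal edges
data Cont (G : TemporalGraph) : TEdge (n G) → List (TEdge (n G)) → Set where
  done : ∀ {e} → Cont G e []
  step : ∀ {e e' rest} → e' ∈ E G → src e' ≡ dst e →
         arr e ≤ dep e' → WithinWait (β G) (arr e) (dep e') →
         Cont G e' rest → Cont G e (e' ∷ rest)

lastE : ∀ {n} → TEdge n → List (TEdge n) → TEdge n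
lastE e []         = e
lastE e (e' ∷ rest) = lastE e' rest

WalkTo : (G : TemporalGraph) → Fin (n G) → TEdge (n G) → List (TEdge (n G)) → Set
WalkTo G s f []         = ⊥
WalkTo G s f (e ∷ rest) = e ∈ E G × src e ≡ s × Cont G e rest × lastE e rest ≡ f

SEWalk : (G : TemporalGraph) → Fin (n G) → TEdge (n G) → List (TEdge (n G)) → Set
SEWalk = WalkTo

STWalkArr : (G : TemporalGraph) → Fin (n G) → Fin (n G) → ℕ → List (TEdge (n G)) → Set
STWalkArr G s t a W = Σ (TEdge (n G)) λ f → WalkTo G s f W × dst f ≡ t × arr f ≡ a

SFo : (G : TemporalGraph) → Fin (n G) → Fin (n G) → List (TEdge (n G)) → Set
SFo G s t W = Σ ℕ λ a → STWalkArr G s t a W ×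
  (∀ X b → STWalkArr G s t b X → ¬ (b < a) × ¬ (b ≡ a × length X < length W))

MinSEWalk : (G : TemporalGraph) → Fin (n G) → TEdge (n G) → List (TEdge (n G)) → Set
MinSEWalk G s e W = SEWalk G s e W × (∀ X → SEWalk G s e X → length W ≤ length X)

InWset : (G : TemporalGraph) → Fin (n G) → TEdge (n G) → Fin (n G) → List (TEdge (n G)) → Set
InWset G s e t W = SFo G s t W × e ∈ W

IsSuffix : (G : TemporalGraph) → Fin (n G) → TEdge (n G) → Fin (n G) → List (TEdge (n G)) → Set
IsSuffix G s e t xs = ∃ λ W → ∃ λ pre → InWset G s e t W × W ≡ pre ++ (e ∷ xs)

HasCount : {A : Set} → (A → Set) → ℕ → Set
HasCount {A} P k = Σ (List A) λ xs → Unique xs × (∀ x → P x ⇔ (x ∈ xs)) × length xs ≡ k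

{-# OPTIONS --safe #-}
-- Cutting a walk of 𝒲_{s,e,t} right after an occurrence of e yields a prefix that is a minimum-length
-- se-walk: any shorter se-walk followed by the same suffix would be an st-walk with the same arrival
-- time and fewer edges. Conversely, any minimum-length se-walk followed by any suffix is again in
-- 𝒲_{s,e,t}, since exchanging prefixes changes neither the arrival time nor the length. All minimum
-- se-walks have the same length, so concatenation is injective on such pairs, and 𝒲_{s,e,t} is in
-- bijection with (minimum se-walks) × (suffixes).
module Submission where

open import Defs
open import Data.Nat using (ℕ; _+_; _*_; _≤_; _<_)
open import Data.Nat.Properties
  using (≤-antisym; <-≤-trans; +-monoˡ-≤; +-monoˡ-<; ≮⇒≥; suc-injective)
open import Data.Fin using (Fin)
open import Data.List using (List; []; _∷_; length; _++_; [_]; map; cartesianProductWith; cartesianProduct)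
open import Data.List.Properties using (length-++; length-map; ++-assoc; ∷-injective)
open import Data.List.Membership.Propositional using (_∈_)
open import Data.List.Membership.Propositional.Properties
  using (∈-map⁺; ∈-map⁻; ∈-cartesianProduct⁺; ∈-cartesianProduct⁻; ∈-∃++; ∈-++⁺ˡ)
open import Data.List.Membership.Propositional.Properties.WithK using (unique∧set⇒bag)
open import Data.List.Relation.Binary.BagAndSetEquality using (∼bag⇒↭)
open import Data.List.Relation.Binary.Permutation.Propositional.Properties
  using (↭-length)
open import Data.List.Relation.Unary.Any using (here; there)
open import Data.List.Relation.Unary.All as All using (All; []; _∷_)
import Data.List.Relation.Unary.All.Properties as All
open import Data.List.Relation.Unary.AllPairs using ([]; _∷_)
open import Data.List.Relation.Unary.Unique.Propositional using (Unique)
import Data.List.Relation.Unary.Unique.Propositional.Properties as Unique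
open import Data.Product using (∃₂; _×_; _,_; proj₁; proj₂; uncurry)
open import Relation.Nullary using (¬_)
open import Relation.Binary.PropositionalEquality
  using (_≡_; refl; sym; trans; cong; cong₂; subst; subst₂)
open import Function.Bundles using (_⇔_; mk⇔; Equivalence)
import Function.Properties.Equivalence as ⇔

module _ {A : Set} where

  unique-length : ∀ {xs ys : List A} → Unique xs → Unique ys → (∀ {x} → x ∈ xs ⇔ x ∈ ys) →
                  length xs ≡ length ys
  unique-length uxs uys xs⇔ys = ↭-length (∼bag⇒↭ (unique∧set⇒bag uxs uys xs⇔ys))

  HasCount-unique : ∀ {P : A → Set} {k k′} → HasCount P k → HasCount P k′ → k ≡ k′
  HasCount-unique (xs , uxs , P⇔xs , refl) (ys , uys , P⇔ys , refl) =
    unique-length uxs uys (λ {x} → ⇔.trans (⇔.sym (P⇔xs x)) (P⇔ys x))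

  ++-cancel-sameLength : ∀ (xs xs′ ys ys′ : List A) → length xs ≡ length xs′ →
                         xs ++ ys ≡ xs′ ++ ys′ → xs ≡ xs′ × ys ≡ ys′
  ++-cancel-sameLength []       []         ys ys′ _   eq = refl , eq
  ++-cancel-sameLength (x ∷ xs) (x′ ∷ xs′) ys ys′ len eq with ∷-injective eq
  ... | refl , eq′ with ++-cancel-sameLength xs xs′ ys ys′ (suc-injective len) eq′
  ... | refl , ys≡ys′ = refl , ys≡ys′

module _ {A B : Set} where

  length-cartesianProductWith : ∀ {C : Set} (f : A → B → C) (xs : List A) (ys : List B) →
                                length (cartesianProductWith f xs ys) ≡ length xs * length ys
  length-cartesianProductWith f []       ys = refl
  length-cartesianProductWith f (x ∷ xs) ys =
    trans (length-++ (map (f x) ys))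
          (cong₂ _+_ (length-map (f x) ys) (length-cartesianProductWith f xs ys))

  Unique-map⁺-injectiveOn : ∀ {S : A → Set} {f : A → B} →
                            (∀ {x y} → S x → S y → f x ≡ f y → x ≡ y) →
                            ∀ {xs} → All S xs → Unique xs → Unique (map f xs)
  Unique-map⁺-injectiveOn inj []         []          = []
  Unique-map⁺-injectiveOn inj (sx ∷ sxs) (x∉ ∷ uxs) =
    All.map⁺ (All.zipWith (λ (sy , x≢y) fx≡fy → x≢y (inj sx sy fx≡fy)) (sxs , x∉))
    ∷ Unique-map⁺-injectiveOn inj sxs uxs

module _ {A B C : Set} {P : A → Set} {Q : B → Set} {R : C → Set} (f : A → B → C)
         (f-injectiveOn : ∀ {a a′ b b′} → P a → P a′ → Q b → Q b′ →
                          f a b ≡ f a′ b′ → a ≡ a′ × b ≡ b′)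
         (R⇔image : ∀ c → R c ⇔ ∃₂ λ a b → P a × Q b × c ≡ f a b) where

  HasCount-image₂ : ∀ {i j} → HasCount P i → HasCount Q j → HasCount R (i * j)
  HasCount-image₂ (as , uas , P⇔as , refl) (bs , ubs , Q⇔bs , refl) =
    map (uncurry f) pairs , unique , R⇔∈ , len
    where
    pairs : List (A × B)
    pairs = cartesianProduct as bs

    P×Q-pairs : All (λ ab → P (proj₁ ab) × Q (proj₂ ab)) pairs
    P×Q-pairs = All.tabulate λ ab∈ →
      let a∈ , b∈ = ∈-cartesianProduct⁻ as bs ab∈
      in Equivalence.from (P⇔as _) a∈ , Equivalence.from (Q⇔bs _) b∈

    unique : Unique (map (uncurry f) pairs)
    unique = Unique-map⁺-injectiveOn
      (λ (pa , qb) (pa′ , qb′) eq → uncurry (cong₂ _,_) (f-injectiveOn pa pa′ qb qb′ eq))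
      P×Q-pairs (Unique.cartesianProduct⁺ uas ubs)

    R⇔∈ : ∀ c → R c ⇔ c ∈ map (uncurry f) pairs
    R⇔∈ c = mk⇔ to from
      where
      to : R c → c ∈ map (uncurry f) pairs
      to rc with Equivalence.to (R⇔image c) rc
      ... | a , b , pa , qb , refl =
        ∈-map⁺ (uncurry f)
               (∈-cartesianProduct⁺ (Equivalence.to (P⇔as a) pa) (Equivalence.to (Q⇔bs b) qb))
      from : c ∈ map (uncurry f) pairs → R c
      from c∈ with ∈-map⁻ (uncurry f) c∈
      ... | (a , b) , ab∈ , refl =
        let pa , qb = All.lookup P×Q-pairs ab∈
        in Equivalence.from (R⇔image c) (a , b , pa , qb , refl)

    len : length (map (uncurry f) pairs) ≡ length as * length bs
    len = trans (length-map (uncurry f) pairs) (length-cartesianProductWith _,_ as bs)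

module _ {m : ℕ} where

  lastE-++ : ∀ (h : TEdge m) ys {xs} → lastE h (ys ++ xs) ≡ lastE (lastE h ys) xs
  lastE-++ h []       = refl
  lastE-++ h (y ∷ ys) = lastE-++ y ys

  lastE∈ : ∀ (h : TEdge m) ys → lastE h ys ∈ h ∷ ys
  lastE∈ h []       = here refl
  lastE∈ h (y ∷ ys) = there (lastE∈ y ys)

  length-++-∷ : ∀ (ys : List (TEdge m)) {e xs} →
                length (ys ++ e ∷ xs) ≡ length (ys ++ [ e ]) + length xs
  length-++-∷ ys {e} {xs} =
    trans (cong length (sym (++-assoc ys [ e ] xs))) (length-++ (ys ++ [ e ]))

module _ (G : TemporalGraph) where

  Cont-++⁻ : ∀ {h e} ys {xs} → Cont G h (ys ++ e ∷ xs) → Cont G h (ys ++ [ e ]) × Cont G e xs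
  Cont-++⁻ []       (step e∈ src≡ arr≤ wait c) = step e∈ src≡ arr≤ wait done , c
  Cont-++⁻ (y ∷ ys) (step y∈ src≡ arr≤ wait c) =
    let c₁ , c₂ = Cont-++⁻ ys c in step y∈ src≡ arr≤ wait c₁ , c₂

  Cont-++⁺ : ∀ {h} ys {xs} → Cont G h ys → Cont G (lastE h ys) xs → Cont G h (ys ++ xs)
  Cont-++⁺ []       done                          c′ = c′
  Cont-++⁺ (y ∷ ys) (step y∈ src≡ arr≤ wait c) c′ = step y∈ src≡ arr≤ wait (Cont-++⁺ ys c c′)

  WalkTo-++⁻ : ∀ {s e f} ys {xs} → WalkTo G s f (ys ++ e ∷ xs) →
               SEWalk G s e (ys ++ [ e ]) × Cont G e xs × lastE e xs ≡ f
  WalkTo-++⁻ []       (e∈ , src≡ , c , last≡) = (e∈ , src≡ , done , refl) , c , last≡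
  WalkTo-++⁻ (h ∷ ys) (h∈ , src≡ , c , last≡) =
    let c₁ , c₂ = Cont-++⁻ ys c
    in (h∈ , src≡ , c₁ , lastE-++ h ys) , c₂ , trans (sym (lastE-++ h ys)) last≡

  WalkTo-++⁺ : ∀ {s e} ys {xs} → SEWalk G s e ys → Cont G e xs → WalkTo G s (lastE e xs) (ys ++ xs)
  WalkTo-++⁺ (h ∷ ys) (h∈ , src≡ , c , refl) c′ = h∈ , src≡ , Cont-++⁺ ys c c′ , lastE-++ h ys

  WalkTo⇒last∈ : ∀ {s e} ys → WalkTo G s e ys → e ∈ ys
  WalkTo⇒last∈ (h ∷ ys) (_ , _ , _ , refl) = lastE∈ h ys

  STWalkArr-exchangePrefix : ∀ {s t e a} ys {xs zs} → STWalkArr G s t a (ys ++ e ∷ xs) →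
                             SEWalk G s e zs → STWalkArr G s t a (zs ++ xs)
  STWalkArr-exchangePrefix {s} ys {xs} {zs} (f , walk , dst≡ , arr≡) se-zs =
    let _ , c , last≡ = WalkTo-++⁻ ys walk
    in f , subst (λ g → WalkTo G s g (zs ++ xs)) last≡ (WalkTo-++⁺ zs se-zs c) , dst≡ , arr≡

module _ (G : TemporalGraph) (s t : Fin (n G)) (e : TEdge (n G)) where

  MinSEWalk++IsSuffix : List (TEdge (n G)) → Set
  MinSEWalk++IsSuffix W = ∃₂ λ ys xs → MinSEWalk G s e ys × IsSuffix G s e t xs × W ≡ ys ++ xs

  InWset⇒MinSEWalk-prefix : ∀ ys {xs} → InWset G s e t (ys ++ e ∷ xs) →
                            MinSEWalk G s e (ys ++ [ e ])
  InWset⇒MinSEWalk-prefix ys {xs} ((a , st-walk@(_ , walk , _) , optimal) , _) =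
    proj₁ (WalkTo-++⁻ G ys walk) , minimal
    where
    minimal : ∀ zs → SEWalk G s e zs → length (ys ++ [ e ]) ≤ length zs
    minimal zs se-zs = ≮⇒≥ λ shorter →
      proj₂ (optimal (zs ++ xs) a (STWalkArr-exchangePrefix G ys st-walk se-zs))
        (refl , subst₂ _<_ (sym (length-++ zs)) (sym (length-++-∷ ys))
                            (+-monoˡ-< (length xs) shorter))

  MinSEWalk-++-IsSuffix⇒InWset : ∀ {ys xs} → MinSEWalk G s e ys → IsSuffix G s e t xs →
                                 InWset G s e t (ys ++ xs)
  MinSEWalk-++-IsSuffix⇒InWset {ys} {xs} (se-ys , min-ys)
                               (_ , pre , ((a , st-walk@(_ , walk , _) , optimal) , _) , refl) =
    (a , STWalkArr-exchangePrefix G pre st-walk se-ys , optimal′) , ∈-++⁺ˡ (WalkTo⇒last∈ G ys se-ys)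
    where
    not-longer : length (ys ++ xs) ≤ length (pre ++ e ∷ xs)
    not-longer = subst₂ _≤_ (sym (length-++ ys)) (sym (length-++-∷ pre))
                   (+-monoˡ-≤ (length xs) (min-ys _ (proj₁ (WalkTo-++⁻ G pre walk))))

    optimal′ : ∀ X b → STWalkArr G s t b X →
               ¬ (b < a) × ¬ (b ≡ a × length X < length (ys ++ xs))
    optimal′ X b st-X =
      let not-earlier , not-shorter = optimal X b st-X
      in not-earlier , λ (b≡a , shorter) → not-shorter (b≡a , <-≤-trans shorter not-longer)

  InWset⇔MinSEWalk++IsSuffix : ∀ W → InWset G s e t W ⇔ MinSEWalk++IsSuffix W
  InWset⇔MinSEWalk++IsSuffix W = mk⇔ to from
    where
    to : InWset G s e t W → MinSEWalk++IsSuffix W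
    to in-W with ∈-∃++ (proj₂ in-W)
    ... | ys , xs , refl = ys ++ [ e ] , xs , InWset⇒MinSEWalk-prefix ys in-W ,
                           (W , ys , in-W , refl) , sym (++-assoc ys [ e ] xs)

    from : MinSEWalk++IsSuffix W → InWset G s e t W
    from (_ , _ , min-ys , suffix-xs , refl) = MinSEWalk-++-IsSuffix⇒InWset min-ys suffix-xs

  ++-injectiveOn-MinSEWalk : ∀ {ys ys′ xs xs′} → MinSEWalk G s e ys → MinSEWalk G s e ys′ →
                             IsSuffix G s e t xs → IsSuffix G s e t xs′ →
                             ys ++ xs ≡ ys′ ++ xs′ → ys ≡ ys′ × xs ≡ xs′
  ++-injectiveOn-MinSEWalk {ys} {ys′} {xs} {xs′} (se-ys , min-ys) (se-ys′ , min-ys′) _ _ =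
    ++-cancel-sameLength ys ys′ xs xs′ (≤-antisym (min-ys ys′ se-ys′) (min-ys′ ys se-ys))

fact4 : (G : TemporalGraph) (s t : Fin (n G)) (e : TEdge (n G)) → ¬ (s ≡ t) → e ∈ E G →
        (σ* σ θ : ℕ) →
        HasCount (InWset G s e t) σ* → HasCount (MinSEWalk G s e) σ → HasCount (IsSuffix G s e t) θ →
        σ* ≡ σ * θ
fact4 G s t e _ _ σ* σ θ count-𝒲 count-σ count-θ =
  HasCount-unique count-𝒲
    (HasCount-image₂ _++_ (++-injectiveOn-MinSEWalk G s t e) (InWset⇔MinSEWalk++IsSuffix G s t e)
                     count-σ count-θ)
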